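{- In $\mathbb{Z}[[s]]$ (limit taken coefficientwise), $$\lim_{n\rightarrow\infty}\frac{G_{n}^{(2)}(2,1,s)}{s^{n}}=\prod_{n\ge1}\frac{1+s^{2n}}{1-s^{2n-1}}.$$
   Context: For a subset $S\subseteq\{1,\dots,n\}$ let $|S|$ be its size and $\sigma(S)=\sum_{i\in S}i$. Segment: with $c(S)$ the number of maximal runs of consecutive integers in $S$, $G_n^{(s)}(m,r,s)=\sum_{S} s^{\sigma(S)}r^{|S|}m^{c(S)}(m-1)^{|S|-c(S)}$. Circle: for $n\ge3$, regard positions cyclically ($n$ and $1$ adjacent) and set $G_n^{(c)}(m,r,s)=\sum_{S} s^{\sigma(S)}r^{|S|}P_S(m)$, where $P_S(m)=m^{c_o(S)}(m-1)^{|S|-c_o(S)}$ for $S\neq\{1,\dots,n\}$ ($c_o(S)$ = number of maximal cyclic runs in $S$) and $P_S(m)=(m-1)^n+(-1)^n(m-1)$ for $S=\{1,\dots,n\}$; for $n\le2$, $G_n^{(c)}:=G_n^{(s)}$. For $n\ge2$, $G_n^{(2)}(m,r,s)$ is the polynomial $\frac{1}{m}\left(G_n^{(c)}(m,r,s)-G_{n-1}^{(s)}(m,r,s)\right)$. -}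

module Defs where

open import Data.Bool using (Bool; true; false; _∧_; not; if_then_else_)
open import Data.Nat as ℕ using (ℕ; zero; suc; _≡ᵇ_; _≤ᵇ_; _%_)
open import Data.Integer as ℤ using (ℤ; +_; -[1+_]; _-_)
open import Data.Integer.DivMod using (_/_)
open import Data.List using (List; []; _∷_; map; _++_; upTo; foldr)

-- A subset S ⊆ {1,…,n} is encoded as a list of n booleans;
-- the entry at position i (0-based) tells whether i+1 ∈ S.
subsets : ℕ → List (List Bool)
subsets zero    = [] ∷ []
subsets (suc n) = map (false ∷_) (subsets n) ++ map (true ∷_) (subsets n)

size : List Bool → ℕ
size []          = 0
size (b ∷ bs) = (if b then 1 else 0) ℕ.+ size bs

sigmaFrom : ℕ → List Bool → ℕ
sigmaFrom k []       = 0
sigmaFrom k (b ∷ bs) = (if b then k else 0) ℕ.+ sigmaFrom (suc k) bs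

sigma : List Bool → ℕ
sigma = sigmaFrom 1

-- number of run starts: elements i ∈ S whose predecessor is not in S,
-- where `prev` is the membership of the predecessor of the first position
runStarts : Bool → List Bool → ℕ
runStarts prev []       = 0
runStarts prev (b ∷ bs) = (if b ∧ not prev then 1 else 0) ℕ.+ runStarts b bs

lastB : List Bool → Bool
lastB []           = false
lastB (b ∷ [])     = b
lastB (_ ∷ b ∷ bs) = lastB (b ∷ bs)

allTrue : List Bool → Bool
allTrue []       = true
allTrue (b ∷ bs) = b ∧ allTrue bs

runsSeg : List Bool → ℕ
runsSeg = runStarts false

-- c_o(S): number of maximal cyclic runs (n adjacent to 1), for S ≠ {1..n}
runsCyc : List Bool → ℕ
runsCyc S = runStarts (lastB S) S

sumℤ : List ℤ → ℤ
sumℤ = foldr ℤ._+_ (+ 0)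

runWeight : ℤ → ℤ → ℕ → ℕ → ℤ
runWeight m r k c = (r ℤ.^ k) ℤ.* (m ℤ.^ c) ℤ.* ((m - + 1) ℤ.^ (k ℕ.∸ c))

withSigma : ℕ → List (List Bool) → List (List Bool)
withSigma j []       = []
withSigma j (S ∷ Ss) = if sigma S ≡ᵇ j then S ∷ withSigma j Ss else withSigma j Ss

-- coefficient of s^j in G_n^{(s)}(m,r,s)
Gseg : ℕ → ℤ → ℤ → ℕ → ℤ
Gseg n m r j =
  sumℤ (map (λ S → runWeight m r (size S) (runsSeg S))
            (withSigma j (subsets n)))

circWeight : ℕ → ℤ → ℤ → List Bool → ℤ
circWeight n m r S =
  if allTrue S
  then (r ℤ.^ n) ℤ.* (((m - + 1) ℤ.^ n) ℤ.+ ((ℤ.- + 1) ℤ.^ n) ℤ.* (m - + 1))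
  else runWeight m r (size S) (runsCyc S)

-- coefficient of s^j in G_n^{(c)}(m,r,s)  (equal to G_n^{(s)} for n ≤ 2)
Gcirc : ℕ → ℤ → ℤ → ℕ → ℤ
Gcirc n m r j =
  if n ≤ᵇ 2 then Gseg n m r j
  else sumℤ (map (circWeight n m r)
                 (withSigma j (subsets n)))

-- coefficient of s^j in G_n^{(2)}(m,r,s) = (G_n^{(c)} - G_{n-1}^{(s)}) / m
-- (the difference is divisible by m, so integer division is exact)
G2 : ℕ → (m : ℤ) → ℤ → .{{ℤ.NonZero m}} → ℕ → ℤ
G2 n m r j = (Gcirc n m r j - Gseg (n ℕ.∸ 1) m r j) / m

Series : Set
Series = ℕ → ℤ

one : Series
one zero    = + 1
one (suc _) = + 0

_⊛_ : Series → Series → Series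
(f ⊛ g) j = sumℤ (map (λ i → f i ℤ.* g (j ℕ.∸ i)) (upTo (suc j)))

onePlusPow : ℕ → Series
onePlusPow a j = (if j ≡ᵇ 0 then + 1 else + 0) ℤ.+ (if j ≡ᵇ a then + 1 else + 0)

-- 1/(1 - s^a) = Σ_t s^{a t}, for a ≥ 1 (written a = suc b)
geomInv : ℕ → Series
geomInv b j = if (j % suc b) ≡ᵇ 0 then + 1 else + 0

partialProd : ℕ → Series
partialProd zero    = one
partialProd (suc M) =
  (partialProd M ⊛ onePlusPow (2 ℕ.* suc M)) ⊛ geomInv (2 ℕ.* M)

-- Split the subsets of {1, …, n} according to whether they contain n.  Those that do not
-- contribute exactly G⁽ˢ⁾ₙ₋₁, so 2·G⁽²⁾ₙ is sⁿ times a sum over S ⊆ {1, …, n−1} of the cyclic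
-- weight of S ∪ {n}.  In degrees below n − 1 the element n − 1 is missing from S, so n opens a
-- new cyclic run and doubles the weight; hence the coefficient of s^(n+k) in G⁽²⁾ₙ is, for large
-- n, the number of finite subsets of {1, 2, …} with sum k, each counted 2^(number of runs not
-- starting at 1) times.  This series satisfies the recurrence of the tiling series W_c(a) (cells
-- a, a+1, … empty, monomers of weight sⁱ, dimers {i, i+1} of weight s^(i+c)) for c = 1.
-- Comparing recurrences gives W_c(1) = (1 + s^(c+1)) W_{c+2}(1), hence
-- W_1(1) = ∏_{i≤M} (1 + s^(2i)) · W_{2M+1}(1).  Modulo s^(2M+1), W_{2M+1}(1) is the
-- distinct-parts product ∏ (1 + sⁱ), which by Euler's identity is ∏ 1/(1 − s^(2i−1)).

module Submission where

open import Defs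
open import Data.Nat using (ℕ; _+_; _≤_; _<_)
open import Data.Integer using (ℤ; +_)
open import Data.Product using (_×_; ∃-syntax)
open import Relation.Binary.PropositionalEquality using (_≡_)

open import Algebra.Bundles using (CommutativeRing)
open import Algebra.Structures using (IsCommutativeRing)
open import Algebra.Solver.Ring.AlmostCommutativeRing using (fromCommutativeRing; _-Raw-AlmostCommutative⟶_)
import Algebra.Properties.AbelianGroup
import Algebra.Properties.Semiring.Exp
import Algebra.Solver.Ring
import Data.Bool
open import Data.Bool using (Bool; true; false; _∧_; not; if_then_else_)
import Data.Bool.Properties as Boolₚ
open import Data.Empty using (⊥-elim)
open import Data.Integer using (-[1+_]; _-_; _≟_; +-*-rawRing)
  renaming (_+_ to _+ℤ_; _*_ to _*ℤ_; -_ to -ℤ_; _^_ to _^ℤ_)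
open import Data.Integer.DivMod using (_/_; _/ℕ_; div-pos-is-/ℕ)
import Data.Integer.Properties as ℤₚ
open import Algebra.Properties.CommutativeSemigroup ℤₚ.+-commutativeSemigroup using (interchange)
open import Data.List using (List; []; _∷_; map; _++_; [_]; length; applyUpTo)
import Data.List.Properties as Listₚ
open import Data.List.Reverse using (reverseView; _∶_∶ʳ_)
open import Data.Maybe using (Maybe; just; nothing)
open import Data.Nat using (zero; suc; _*_; _∸_; _≡ᵇ_; _%_; z≤n; s≤s)
import Data.Nat.DivMod as ℕ
import Data.Nat.Properties as ℕₚ
open import Data.Product using (_,_; proj₁)
open import Data.Sum using (_⊎_; inj₁; inj₂)
open import Function using (_∘_; id)
open import Relation.Binary.PropositionalEquality
  using (refl; sym; trans; cong; cong₂; subst; subst₂; module ≡-Reasoning)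
import Relation.Binary.Reasoning.Setoid
open import Relation.Nullary using (yes; no)

module PowerSeries where

  open import Defs public using () renaming (_⊛_ to infixl 7 _⊗_)

  infix 4 _≈_
  _≈_ : Series → Series → Set
  f ≈ g = ∀ j → f j ≡ g j

  infixl 6 _⊕_
  _⊕_ : Series → Series → Series
  (f ⊕ g) j = f j +ℤ g j

  ⊝_ : Series → Series
  (⊝ f) j = -ℤ f j

  infixl 6 _⊖_
  _⊖_ : Series → Series → Series
  f ⊖ g = f ⊕ ⊝ g

  0ₛ : Series
  0ₛ _ = + 0

  shift : Series → Series
  shift f zero    = + 0
  shift f (suc j) = f j

  private
    tail : Series → Series
    tail f j = f (suc j)

    cauchy : Series → Series → Series
    cauchy f g zero    = f 0 *ℤ g 0
    cauchy f g (suc j) = f 0 *ℤ g (suc j) +ℤ cauchy (tail f) g j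

    scale : ℤ → Series → Series
    scale c f j = c *ℤ f j

    map-applyUpTo : ∀ {A B : Set} (h : A → B) (k : ℕ → A) n →
                    map h (applyUpTo k n) ≡ applyUpTo (h ∘ k) n
    map-applyUpTo h k zero    = refl
    map-applyUpTo h k (suc n) = cong (h (k 0) ∷_) (map-applyUpTo h (k ∘ suc) n)

    sum-applyUpTo : ∀ f g j →
      sumℤ (applyUpTo (λ i → f i *ℤ g (j ∸ i)) (suc j)) ≡ cauchy f g j
    sum-applyUpTo f g zero    = ℤₚ.+-identityʳ _
    sum-applyUpTo f g (suc j) = cong ((f 0 *ℤ g (suc j)) +ℤ_) (sum-applyUpTo (tail f) g j)

    ⊗≈cauchy : ∀ f g → f ⊗ g ≈ cauchy f g
    ⊗≈cauchy f g j = trans (cong sumℤ (map-applyUpTo (λ i → f i *ℤ g (j ∸ i)) id (suc j))) (sum-applyUpTo f g j)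

    cauchy-cong : ∀ {f f′ g g′} → f ≈ f′ → g ≈ g′ → cauchy f g ≈ cauchy f′ g′
    cauchy-cong f≈ g≈ zero    = cong₂ _*ℤ_ (f≈ 0) (g≈ 0)
    cauchy-cong f≈ g≈ (suc j) =
      cong₂ _+ℤ_ (cong₂ _*ℤ_ (f≈ 0) (g≈ (suc j))) (cauchy-cong (f≈ ∘ suc) g≈ j)

    cauchy-distribʳ : ∀ f g h → cauchy (f ⊕ g) h ≈ cauchy f h ⊕ cauchy g h
    cauchy-distribʳ f g h zero    = ℤₚ.*-distribʳ-+ (h 0) (f 0) (g 0)
    cauchy-distribʳ f g h (suc j) =
      trans (cong₂ _+ℤ_ (ℤₚ.*-distribʳ-+ (h (suc j)) (f 0) (g 0)) (cauchy-distribʳ (tail f) (tail g) h j))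
            (interchange (f 0 *ℤ h (suc j)) (g 0 *ℤ h (suc j)) (cauchy (tail f) h j) (cauchy (tail g) h j))

    cauchy-peelʳ : ∀ f g j → cauchy f g (suc j) ≡ f (suc j) *ℤ g 0 +ℤ cauchy f (tail g) j
    cauchy-peelʳ f g zero    = ℤₚ.+-comm (f 0 *ℤ g 1) (f 1 *ℤ g 0)
    cauchy-peelʳ f g (suc j) = begin
      a +ℤ cauchy (tail f) g (suc j)    ≡⟨ cong (a +ℤ_) (cauchy-peelʳ (tail f) g j) ⟩
      a +ℤ (b +ℤ r)                    ≡⟨ ℤₚ.+-assoc a b r ⟨
      a +ℤ b +ℤ r                      ≡⟨ cong (_+ℤ r) (ℤₚ.+-comm a b) ⟩
      b +ℤ a +ℤ r                      ≡⟨ ℤₚ.+-assoc b a r ⟩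
      b +ℤ (a +ℤ r)                    ∎
      where
      open ≡-Reasoning
      a = f 0 *ℤ g (suc (suc j))
      b = f (suc (suc j)) *ℤ g 0
      r = cauchy (tail f) (tail g) j

    cauchy-comm : ∀ f g → cauchy f g ≈ cauchy g f
    cauchy-comm f g zero    = ℤₚ.*-comm (f 0) (g 0)
    cauchy-comm f g (suc j) =
      trans (cong₂ _+ℤ_ (ℤₚ.*-comm (f 0) (g (suc j))) (cauchy-comm (tail f) g j))
            (sym (cauchy-peelʳ g f j))

    cauchy-scale : ∀ c g h → cauchy (scale c g) h ≈ scale c (cauchy g h)
    cauchy-scale c g h zero    = ℤₚ.*-assoc c (g 0) (h 0)
    cauchy-scale c g h (suc j) =
      trans (cong₂ _+ℤ_ (ℤₚ.*-assoc c (g 0) (h (suc j))) (cauchy-scale c (tail g) h j))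
            (sym (ℤₚ.*-distribˡ-+ c _ _))

    cauchy-shift : ∀ f h → cauchy (shift f) h ≈ shift (cauchy f h)
    cauchy-shift f h zero    = ℤₚ.*-zeroˡ (h 0)
    cauchy-shift f h (suc j) = trans (cong (_+ℤ cauchy f h j) (ℤₚ.*-zeroˡ (h (suc j)))) (ℤₚ.+-identityˡ _)

    cauchy-split : ∀ f g → cauchy f g ≈ scale (f 0) g ⊕ shift (cauchy (tail f) g)
    cauchy-split f g zero    = sym (ℤₚ.+-identityʳ _)
    cauchy-split f g (suc j) = refl

    cauchy-assoc : ∀ f g h → cauchy (cauchy f g) h ≈ cauchy f (cauchy g h)
    cauchy-assoc f g h j = begin
      cauchy (cauchy f g) h j
        ≡⟨ cauchy-cong (cauchy-split f g) (λ _ → refl) j ⟩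
      cauchy (scale (f 0) g ⊕ shift (cauchy (tail f) g)) h j
        ≡⟨ cauchy-distribʳ _ _ h j ⟩
      cauchy (scale (f 0) g) h j +ℤ cauchy (shift (cauchy (tail f) g)) h j
        ≡⟨ cong₂ _+ℤ_ (cauchy-scale (f 0) g h j) (cauchy-shift _ h j) ⟩
      scale (f 0) (cauchy g h) j +ℤ shift (cauchy (cauchy (tail f) g) h) j
        ≡⟨ cong (scale (f 0) (cauchy g h) j +ℤ_) (shift-assoc j) ⟩
      scale (f 0) (cauchy g h) j +ℤ shift (cauchy (tail f) (cauchy g h)) j
        ≡⟨ cauchy-split f (cauchy g h) j ⟨
      cauchy f (cauchy g h) j ∎
      where
      open ≡-Reasoning
      shift-assoc : shift (cauchy (cauchy (tail f) g) h) ≈ shift (cauchy (tail f) (cauchy g h))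
      shift-assoc zero    = refl
      shift-assoc (suc i) = cauchy-assoc (tail f) g h i

    cauchy-zeroˡ : ∀ {f} g → f ≈ 0ₛ → cauchy f g ≈ 0ₛ
    cauchy-zeroˡ g f≈0 zero    = cong (_*ℤ g 0) (f≈0 0)
    cauchy-zeroˡ g f≈0 (suc j) =
      cong₂ _+ℤ_ (cong (_*ℤ g (suc j)) (f≈0 0)) (cauchy-zeroˡ g (f≈0 ∘ suc) j)

    cauchy-identityˡ : ∀ g → cauchy one g ≈ g
    cauchy-identityˡ g j =
      trans (cauchy-split one g j)
            (trans (cong₂ _+ℤ_ (ℤₚ.*-identityˡ (g j)) (no-tail j)) (ℤₚ.+-identityʳ _))
      where
      no-tail : shift (cauchy (tail one) g) ≈ 0ₛ
      no-tail zero    = refl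
      no-tail (suc i) = cauchy-zeroˡ g (λ _ → refl) i

  ⊗-cong : ∀ {f f′ g g′} → f ≈ f′ → g ≈ g′ → f ⊗ g ≈ f′ ⊗ g′
  ⊗-cong {f} {f′} {g} {g′} f≈ g≈ j =
    trans (⊗≈cauchy f g j) (trans (cauchy-cong f≈ g≈ j) (sym (⊗≈cauchy f′ g′ j)))

  ⊗-comm : ∀ f g → f ⊗ g ≈ g ⊗ f
  ⊗-comm f g j = trans (⊗≈cauchy f g j) (trans (cauchy-comm f g j) (sym (⊗≈cauchy g f j)))

  ⊗-assoc : ∀ f g h → (f ⊗ g) ⊗ h ≈ f ⊗ (g ⊗ h)
  ⊗-assoc f g h j = begin
    ((f ⊗ g) ⊗ h) j           ≡⟨ ⊗≈cauchy (f ⊗ g) h j ⟩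
    cauchy (f ⊗ g) h j        ≡⟨ cauchy-cong (⊗≈cauchy f g) (λ _ → refl) j ⟩
    cauchy (cauchy f g) h j   ≡⟨ cauchy-assoc f g h j ⟩
    cauchy f (cauchy g h) j   ≡⟨ cauchy-cong (λ _ → refl) (⊗≈cauchy g h) j ⟨
    cauchy f (g ⊗ h) j        ≡⟨ ⊗≈cauchy f (g ⊗ h) j ⟨
    (f ⊗ (g ⊗ h)) j           ∎
    where open ≡-Reasoning

  private
    ⊗-distribʳ : ∀ h f g → (f ⊕ g) ⊗ h ≈ f ⊗ h ⊕ g ⊗ h
    ⊗-distribʳ h f g j =
      trans (⊗≈cauchy (f ⊕ g) h j)
            (trans (cauchy-distribʳ f g h j) (sym (cong₂ _+ℤ_ (⊗≈cauchy f h j) (⊗≈cauchy g h j))))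

  ⊗-identityˡ : ∀ g → one ⊗ g ≈ g
  ⊗-identityˡ g j = trans (⊗≈cauchy one g j) (cauchy-identityˡ g j)

  private
    ⊗-shiftˡ : ∀ f g → shift f ⊗ g ≈ shift (f ⊗ g)
    ⊗-shiftˡ f g zero    = trans (⊗≈cauchy (shift f) g 0) (cauchy-shift f g 0)
    ⊗-shiftˡ f g (suc j) =
      trans (⊗≈cauchy (shift f) g (suc j)) (trans (cauchy-shift f g (suc j)) (sym (⊗≈cauchy f g j)))

  ≈-refl : ∀ {f} → f ≈ f
  ≈-refl _ = refl

  ≈-sym : ∀ {f g} → f ≈ g → g ≈ f
  ≈-sym f≈g j = sym (f≈g j)

  ≈-trans : ∀ {f g h} → f ≈ g → g ≈ h → f ≈ h
  ≈-trans f≈g g≈h j = trans (f≈g j) (g≈h j)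

  isCommutativeRing : IsCommutativeRing _≈_ _⊕_ _⊗_ ⊝_ 0ₛ one
  isCommutativeRing = record
    { isRing = record
      { +-isAbelianGroup = record
        { isGroup = record
          { isMonoid = record
            { isSemigroup = record
              { isMagma = record
                { isEquivalence = record { refl = ≈-refl ; sym = ≈-sym ; trans = ≈-trans }
                ; ∙-cong = λ f≈ g≈ j → cong₂ _+ℤ_ (f≈ j) (g≈ j) }
              ; assoc = λ f g h j → ℤₚ.+-assoc (f j) (g j) (h j) }
            ; identity = (λ f j → ℤₚ.+-identityˡ (f j)) , (λ f j → ℤₚ.+-identityʳ (f j)) }
          ; inverse = (λ f j → ℤₚ.+-inverseˡ (f j)) , (λ f j → ℤₚ.+-inverseʳ (f j))
          ; ⁻¹-cong = λ f≈ j → cong -ℤ_ (f≈ j) }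
        ; comm = λ f g j → ℤₚ.+-comm (f j) (g j) }
      ; *-cong = ⊗-cong
      ; *-assoc = ⊗-assoc
      ; *-identity = ⊗-identityˡ , (λ g → ≈-trans (⊗-comm g one) (⊗-identityˡ g))
      ; distrib = (λ h f g → ≈-trans (⊗-comm h (f ⊕ g))
                     (≈-trans (⊗-distribʳ h f g) (λ j → cong₂ _+ℤ_ (⊗-comm f h j) (⊗-comm g h j))))
                , ⊗-distribʳ }
    ; *-comm = ⊗-comm }

  ring : CommutativeRing _ _
  ring = record { isCommutativeRing = isCommutativeRing }

  private
    constant : ℤ → Series
    constant c zero    = c
    constant c (suc _) = + 0

  -- const (+ 1) is one on the nose, so that the solver's constant 1 is the series one.
  const : ℤ → Series
  const (+ 1) = one
  const c     = constant c

  private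
    const≈constant : ∀ c → const c ≈ constant c
    const≈constant (+ 0)           _       = refl
    const≈constant (+ 1)           zero    = refl
    const≈constant (+ 1)           (suc _) = refl
    const≈constant (+ suc (suc _)) _       = refl
    const≈constant -[1+ _ ]        _       = refl

    constant-+ : ∀ a b → constant (a +ℤ b) ≈ constant a ⊕ constant b
    constant-+ a b zero    = refl
    constant-+ a b (suc _) = refl

    constant-* : ∀ a b → constant (a *ℤ b) ≈ constant a ⊗ constant b
    constant-* a b j = sym (trans (⊗≈cauchy (constant a) (constant b) j) (product j))
      where
      product : ∀ j → cauchy (constant a) (constant b) j ≡ constant (a *ℤ b) j
      product zero    = refl
      product (suc j) = trans (cong (_+ℤ cauchy (tail (constant a)) (constant b) j) (ℤₚ.*-zeroʳ a))
                              (trans (ℤₚ.+-identityˡ _) (cauchy-zeroˡ (constant b) (λ _ → refl) j))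

    constant-- : ∀ a → constant (-ℤ a) ≈ ⊝ constant a
    constant-- a zero    = refl
    constant-- a (suc _) = refl

    const-homomorphism : +-*-rawRing -Raw-AlmostCommutative⟶ fromCommutativeRing ring
    const-homomorphism = record
      { ⟦_⟧    = const
      ; +-homo = λ a b → ≈-trans (const≈constant (a +ℤ b)) (≈-trans (constant-+ a b)
                   (λ j → sym (cong₂ _+ℤ_ (const≈constant a j) (const≈constant b j))))
      ; *-homo = λ a b → ≈-trans (const≈constant (a *ℤ b)) (≈-trans (constant-* a b)
                   (⊗-cong (≈-sym (const≈constant a)) (≈-sym (const≈constant b))))
      ; -‿homo = λ a → ≈-trans (const≈constant (-ℤ a)) (≈-trans (constant-- a)
                   (λ j → sym (cong -ℤ_ (const≈constant a j))))
      ; 0-homo = λ { zero → refl ; (suc _) → refl }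
      ; 1-homo = ≈-refl
      }

    const-≟ : ∀ a b → Maybe (const a ≈ const b)
    const-≟ a b with a ≟ b
    ... | yes refl = just ≈-refl
    ... | no _     = nothing

  const-⊗ : ∀ c f j → (const c ⊗ f) j ≡ c *ℤ f j
  const-⊗ c f j = begin
    (const c ⊗ f) j                                         ≡⟨ ⊗-cong (const≈constant c) (≈-refl {f}) j ⟩
    (constant c ⊗ f) j                                      ≡⟨ ⊗≈cauchy (constant c) f j ⟩
    cauchy (constant c) f j                                 ≡⟨ cauchy-split (constant c) f j ⟩
    c *ℤ f j +ℤ shift (cauchy (tail (constant c)) f) j      ≡⟨ cong (c *ℤ f j +ℤ_) (no-tail j) ⟩
    c *ℤ f j +ℤ + 0                                         ≡⟨ ℤₚ.+-identityʳ _ ⟩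
    c *ℤ f j                                                ∎
    where
    open ≡-Reasoning
    no-tail : ∀ j → shift (cauchy (tail (constant c)) f) j ≡ + 0
    no-tail zero    = refl
    no-tail (suc j) = cauchy-zeroˡ f (λ _ → refl) j

  open Algebra.Solver.Ring +-*-rawRing (fromCommutativeRing ring) const-homomorphism const-≟
    public using (solve; _:=_; _:+_; _:*_; _:-_; con)

  s : Series
  s = shift one

  open Algebra.Properties.Semiring.Exp (CommutativeRing.semiring ring) public
    using (_^_; ^-homo-*)

  s-⊗ : ∀ f → s ⊗ f ≈ shift f
  s-⊗ f = ≈-trans (⊗-shiftˡ one f) (λ { zero → refl ; (suc j) → ⊗-identityˡ f j })

  s^-⊗ : ∀ e f → s ^ suc e ⊗ f ≈ shift (s ^ e ⊗ f)
  s^-⊗ e f = ≈-trans (⊗-assoc s (s ^ e) f) (s-⊗ (s ^ e ⊗ f))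

  s^-⊗-shifted : ∀ e f i → (s ^ e ⊗ f) (e + i) ≡ f i
  s^-⊗-shifted zero    f i = ⊗-identityˡ f i
  s^-⊗-shifted (suc e) f i = trans (s^-⊗ e f (suc (e + i))) (s^-⊗-shifted e f i)

  infix 4 _≈[_]_
  record _≈[_]_ (f : Series) (n : ℕ) (g : Series) : Set where
    constructor agree-below
    field coeff : ∀ j → j < n → f j ≡ g j
  open _≈[_]_ public

  ≈⇒≈[] : ∀ {f g n} → f ≈ g → f ≈[ n ] g
  ≈⇒≈[] f≈g = agree-below λ j _ → f≈g j

  ≈[]⇒≈ : ∀ {f g} → (∀ n → f ≈[ n ] g) → f ≈ g
  ≈[]⇒≈ f≈g j = coeff (f≈g (suc j)) j ℕₚ.≤-refl

  ≈[]-refl : ∀ {f n} → f ≈[ n ] f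
  ≈[]-refl = agree-below λ _ _ → refl

  ≈[]-sym : ∀ {f g n} → f ≈[ n ] g → g ≈[ n ] f
  ≈[]-sym (agree-below f≈g) = agree-below λ j j<n → sym (f≈g j j<n)

  ≈[]-trans : ∀ {f g h n} → f ≈[ n ] g → g ≈[ n ] h → f ≈[ n ] h
  ≈[]-trans (agree-below f≈g) (agree-below g≈h) = agree-below λ j j<n → trans (f≈g j j<n) (g≈h j j<n)

  ≈[]-weaken : ∀ {f g m n} → m ≤ n → f ≈[ n ] g → f ≈[ m ] g
  ≈[]-weaken m≤n (agree-below f≈g) = agree-below λ j j<m → f≈g j (ℕₚ.<-≤-trans j<m m≤n)

  ≈[]-⊕ : ∀ {f f′ g g′ n} → f ≈[ n ] f′ → g ≈[ n ] g′ → f ⊕ g ≈[ n ] f′ ⊕ g′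
  ≈[]-⊕ (agree-below f≈) (agree-below g≈) = agree-below λ j j<n → cong₂ _+ℤ_ (f≈ j j<n) (g≈ j j<n)

  ≈[]-⊝ : ∀ {f g n} → f ≈[ n ] g → ⊝ f ≈[ n ] ⊝ g
  ≈[]-⊝ (agree-below f≈g) = agree-below λ j j<n → cong -ℤ_ (f≈g j j<n)

  private
    cauchy-local : ∀ {f f′ g g′} j → (∀ i → i ≤ j → f i ≡ f′ i) → (∀ i → i ≤ j → g i ≡ g′ i) →
                   cauchy f g j ≡ cauchy f′ g′ j
    cauchy-local zero    f≈ g≈ = cong₂ _*ℤ_ (f≈ 0 z≤n) (g≈ 0 z≤n)
    cauchy-local (suc j) f≈ g≈ =
      cong₂ _+ℤ_ (cong₂ _*ℤ_ (f≈ 0 z≤n) (g≈ (suc j) ℕₚ.≤-refl))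
                 (cauchy-local j (λ i i≤j → f≈ (suc i) (s≤s i≤j)) (λ i i≤j → g≈ i (ℕₚ.m≤n⇒m≤1+n i≤j)))

  ≈[]-⊗ : ∀ {f f′ g g′ n} → f ≈[ n ] f′ → g ≈[ n ] g′ → f ⊗ g ≈[ n ] f′ ⊗ g′
  ≈[]-⊗ {f} {f′} {g} {g′} f≈ g≈ = agree-below λ j j<n →
    trans (⊗≈cauchy f g j)
          (trans (cauchy-local j (below f≈ j<n) (below g≈ j<n)) (sym (⊗≈cauchy f′ g′ j)))
    where
    below : ∀ {h h′ n j} → h ≈[ n ] h′ → j < n → ∀ i → i ≤ j → h i ≡ h′ i
    below h≈ j<n i i≤j = coeff h≈ i (ℕₚ.≤-<-trans i≤j j<n)

  ≈[]-shift : ∀ {f g n} → f ≈[ n ] g → shift f ≈[ suc n ] shift g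
  ≈[]-shift (agree-below f≈g) = agree-below λ
    { zero    _         → refl
    ; (suc j) (s≤s j<n) → f≈g j j<n }

  ≈[]-s^ : ∀ e {f g n} → f ≈[ n ] g → s ^ e ⊗ f ≈[ e + n ] s ^ e ⊗ g
  ≈[]-s^ zero    {f} {g} f≈g =
    ≈[]-trans (≈⇒≈[] (⊗-identityˡ f)) (≈[]-trans f≈g (≈⇒≈[] (≈-sym (⊗-identityˡ g))))
  ≈[]-s^ (suc e) {f} {g} f≈g =
    ≈[]-trans (≈⇒≈[] (s^-⊗ e f)) (≈[]-trans (≈[]-shift (≈[]-s^ e f≈g)) (≈⇒≈[] (≈-sym (s^-⊗ e g))))

  s^-⊗-≈[]-0 : ∀ e f → s ^ e ⊗ f ≈[ e ] 0ₛ
  s^-⊗-≈[]-0 zero    f = agree-below λ _ ()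
  s^-⊗-≈[]-0 (suc e) f = agree-below λ
    { zero    _         → s^-⊗ e f 0
    ; (suc j) (s≤s j<e) → trans (s^-⊗ e f (suc j)) (coeff (s^-⊗-≈[]-0 e f) j j<e) }

  s^-≈[]-0 : ∀ e → s ^ e ≈[ e ] 0ₛ
  s^-≈[]-0 e = ≈[]-trans (≈⇒≈[] (≈-sym (CommutativeRing.*-identityʳ ring (s ^ e)))) (s^-⊗-≈[]-0 e one)

open PowerSeries
open CommutativeRing ring using (*-identityʳ; +-identityʳ; zeroˡ; zeroʳ; -‿cong; +-cong; +-congʳ; +-congˡ)
module ≈-Reasoning = Relation.Binary.Reasoning.Setoid (CommutativeRing.setoid ring)

below-or-shifted : ∀ e j → j < e ⊎ ∃[ i ] j ≡ e + i
below-or-shifted zero    j       = inj₂ (j , refl)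
below-or-shifted (suc e) zero    = inj₁ (s≤s z≤n)
below-or-shifted (suc e) (suc j) with below-or-shifted e j
... | inj₁ j<e       = inj₁ (s≤s j<e)
... | inj₂ (i , refl) = inj₂ (i , refl)

≡⇒≈ : ∀ {f g} → f ≡ g → f ≈ g
≡⇒≈ refl = ≈-refl

one⊕s^-cong : ∀ {d e} → d ≡ e → one ⊕ s ^ d ≈ one ⊕ s ^ e
one⊕s^-cong refl = ≈-refl

one⊖s^-cong : ∀ {d e} → d ≡ e → one ⊖ s ^ d ≈ one ⊖ s ^ e
one⊖s^-cong refl = ≈-refl

one⊕s^-≈[]-one : ∀ e → one ⊕ s ^ e ≈[ e ] one
one⊕s^-≈[]-one e =
  ≈[]-trans {g = one ⊕ 0ₛ} (≈[]-⊕ (≈[]-refl {one}) (s^-≈[]-0 e)) (≈⇒≈[] (+-identityʳ one))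

one⊖s^-≈[]-one : ∀ e → one ⊖ s ^ e ≈[ e ] one
one⊖s^-≈[]-one e =
  ≈[]-trans {g = one ⊕ 0ₛ} (≈[]-⊕ (≈[]-refl {one}) (≈[]-⊝ (s^-≈[]-0 e))) (≈⇒≈[] (+-identityʳ one))

⊗-≈[]-0ˡ : ∀ {f n} g → f ≈[ n ] 0ₛ → f ⊗ g ≈[ n ] 0ₛ
⊗-≈[]-0ˡ g f≈0 = ≈[]-trans (≈[]-⊗ f≈0 (≈[]-refl {g})) (≈⇒≈[] (zeroˡ g))

∏ : (ℕ → Series) → ℕ → Series
∏ f zero    = one
∏ f (suc m) = ∏ f m ⊗ f m

∏-cons : ∀ f m → ∏ f (suc m) ≈ f 0 ⊗ ∏ (λ i → f (suc i)) m
∏-cons f zero    = ≈-trans (⊗-identityˡ (f 0)) (≈-sym (*-identityʳ (f 0)))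
∏-cons f (suc m) = begin
  ∏ f (suc m) ⊗ f (suc m)                    ≈⟨ ⊗-cong (∏-cons f m) ≈-refl ⟩
  f 0 ⊗ ∏ (λ i → f (suc i)) m ⊗ f (suc m)   ≈⟨ ⊗-assoc (f 0) _ (f (suc m)) ⟩
  f 0 ⊗ ∏ (λ i → f (suc i)) (suc m)         ∎
  where open ≈-Reasoning

∏-cong : ∀ {f g} m → (∀ i → f i ≈ g i) → ∏ f m ≈ ∏ g m
∏-cong zero    f≈g = ≈-refl
∏-cong (suc m) f≈g = ⊗-cong (∏-cong m f≈g) (f≈g m)

∏-⊗ : ∀ f g m → ∏ f m ⊗ ∏ g m ≈ ∏ (λ i → f i ⊗ g i) m
∏-⊗ f g zero    = ⊗-identityˡ one
∏-⊗ f g (suc m) = begin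
  ∏ f m ⊗ f m ⊗ (∏ g m ⊗ g m)     ≈⟨ solve 4 (λ F x G y → F :* x :* (G :* y) := F :* G :* (x :* y))
                                               ≈-refl (∏ f m) (f m) (∏ g m) (g m) ⟩
  ∏ f m ⊗ ∏ g m ⊗ (f m ⊗ g m)     ≈⟨ ⊗-cong (∏-⊗ f g m) ≈-refl ⟩
  ∏ (λ i → f i ⊗ g i) (suc m)     ∎
  where open ≈-Reasoning

∏-≈[]-one : ∀ {f n} m → (∀ i → f i ≈[ n ] one) → ∏ f m ≈[ n ] one
∏-≈[]-one zero    f≈one = ≈[]-refl
∏-≈[]-one (suc m) f≈one =
  ≈[]-trans (≈[]-⊗ (∏-≈[]-one m f≈one) (f≈one m)) (≈⇒≈[] (⊗-identityˡ one))

-- Tiling series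

-- Cell i of the window {a, …, a+f−1} is empty, a monomer (weight sⁱ), or the first cell of a
-- dimer {i, i+1} (weight s^(i+c)); a last dimer may overhang the window.
tilings : ℕ → ℕ → ℕ → Series
tilings zero    c a = one
tilings (suc f) c a =
  (one ⊕ s ^ a) ⊗ tilings f c (suc a) ⊕ s ^ a ⊗ s ^ c ⊗ tilings f c (suc (suc a))

dimer-≈[] : ∀ a c {y y′ n} → y ≈[ n ] y′ → s ^ a ⊗ s ^ c ⊗ y ≈[ a + (c + n) ] s ^ a ⊗ s ^ c ⊗ y′
dimer-≈[] a c {y} {y′} y≈y′ =
  ≈[]-trans (≈⇒≈[] (⊗-assoc (s ^ a) (s ^ c) y))
            (≈[]-trans (≈[]-s^ a (≈[]-s^ c y≈y′)) (≈⇒≈[] (≈-sym (⊗-assoc (s ^ a) (s ^ c) y′))))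

dimer-≈[]-0 : ∀ a c y → s ^ a ⊗ s ^ c ⊗ y ≈[ a + c ] 0ₛ
dimer-≈[]-0 a c y = ≈[]-trans (≈⇒≈[] (⊗-cong (≈-sym (^-homo-* s a c)) (≈-refl {y}))) (s^-⊗-≈[]-0 (a + c) y)

tilings-≈[]-one : ∀ f c a → tilings f c a ≈[ a ] one
tilings-≈[]-one zero    c a = ≈[]-refl
tilings-≈[]-one (suc f) c a =
  ≈[]-trans (≈[]-⊕ (≈[]-⊗ (one⊕s^-≈[]-one a) (≈[]-weaken (ℕₚ.n≤1+n a) (tilings-≈[]-one f c (suc a))))
                   (≈[]-weaken (ℕₚ.m≤m+n a c) (dimer-≈[]-0 a c _)))
            (≈⇒≈[] (≈-trans (+-identityʳ (one ⊗ one)) (⊗-identityˡ one)))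

tilings-stable : ∀ {f f′} c a → f ≤ f′ → tilings f c a ≈[ a + f ] tilings f′ c a
tilings-stable {zero}  {f′}    c a _ =
  ≈[]-weaken (ℕₚ.≤-reflexive (ℕₚ.+-identityʳ a)) (≈[]-sym (tilings-≈[]-one f′ c a))
tilings-stable {suc f} {suc f′} c a (s≤s f≤f′) =
  ≈[]-⊕ (≈[]-⊗ (≈[]-refl {one ⊕ s ^ a})
                (≈[]-weaken (ℕₚ.≤-reflexive (ℕₚ.+-suc a f)) (tilings-stable c (suc a) f≤f′)))
        (≈[]-weaken (ℕₚ.+-monoʳ-≤ a (ℕₚ.m≤n⇒m≤o+n c (s≤s (ℕₚ.m≤n+m f (suc a)))))
                    (dimer-≈[] a c (tilings-stable c (suc (suc a)) f≤f′)))

-- The coefficient of sʲ no longer depends on the window once it has j + 1 cells.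
tilings∞ : ℕ → ℕ → Series
tilings∞ c a j = tilings (suc j) c a j

tilings∞≈[]tilings : ∀ f c a → tilings∞ c a ≈[ a + f ] tilings f c a
tilings∞≈[]tilings f c a = agree-below λ j j<a+f → compare j j<a+f (ℕₚ.≤-total (suc j) f)
  where
  compare : ∀ j → j < a + f → suc j ≤ f ⊎ f ≤ suc j → tilings∞ c a j ≡ tilings f c a j
  compare j _     (inj₁ sj≤f) = coeff (tilings-stable c a sj≤f) j (ℕₚ.m≤n+m (suc j) a)
  compare j j<a+f (inj₂ f≤sj) = sym (coeff (tilings-stable c a f≤sj) j j<a+f)

tilings∞-≈[]-one : ∀ c a → tilings∞ c a ≈[ a ] one
tilings∞-≈[]-one c a = agree-below λ j → coeff (tilings-≈[]-one (suc j) c a) j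

tilings∞-unfold : ∀ c a →
  tilings∞ c a ≈ (one ⊕ s ^ a) ⊗ tilings∞ c (suc a) ⊕ s ^ a ⊗ s ^ c ⊗ tilings∞ c (suc (suc a))
tilings∞-unfold c a = ≈[]⇒≈ λ n →
  ≈[]-trans (≈[]-weaken (ℕₚ.m≤n⇒m≤o+n a (ℕₚ.n≤1+n n)) (tilings∞≈[]tilings (suc n) c a))
            (≈[]-sym (≈[]-⊕ (≈[]-⊗ (≈[]-refl {one ⊕ s ^ a})
                                   (≈[]-weaken (ℕₚ.m≤n+m n (suc a)) (tilings∞≈[]tilings n c (suc a))))
                            (≈[]-weaken (ℕₚ.m≤n⇒m≤o+n a (ℕₚ.m≤n⇒m≤o+n c (ℕₚ.m≤n+m n (suc (suc a)))))
                                        (dimer-≈[] a c (tilings∞≈[]tilings n c (suc (suc a)))))))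

-- Below n, the coefficients at index a are determined by those at a+1 and a+2,
-- and for a ≥ n they are the boundary values.
recurrence-unique : ∀ (α β X Y : ℕ → Series) →
  (∀ a → X a ≈ α a ⊗ X (suc a) ⊕ β a ⊗ X (suc (suc a))) →
  (∀ a → Y a ≈ α a ⊗ Y (suc a) ⊕ β a ⊗ Y (suc (suc a))) →
  (∀ a → X a ≈[ a ] Y a) → ∀ a → X a ≈ Y a
recurrence-unique α β X Y X-rec Y-rec boundary a = ≈[]⇒≈ λ n → agree n n a (ℕₚ.m≤m+n n a)
  where
  agree : ∀ n k a → n ≤ k + a → X a ≈[ n ] Y a
  agree n zero    a n≤a     = ≈[]-weaken n≤a (boundary a)
  agree n (suc k) a n≤1+k+a =
    ≈[]-trans (≈⇒≈[] (X-rec a))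
      (≈[]-trans (≈[]-⊕ (≈[]-⊗ (≈[]-refl {α a}) (agree n k (suc a) n≤k+1+a))
                        (≈[]-⊗ (≈[]-refl {β a}) (agree n k (suc (suc a))
                                  (ℕₚ.≤-trans n≤k+1+a (ℕₚ.+-monoʳ-≤ k (ℕₚ.n≤1+n (suc a)))))))
                 (≈⇒≈[] (≈-sym (Y-rec a))))
    where
    n≤k+1+a : n ≤ k + suc a
    n≤k+1+a = ℕₚ.≤-trans n≤1+k+a (ℕₚ.≤-reflexive (sym (ℕₚ.+-suc k a)))

raisedForm : ℕ → ℕ → Series → Series → Series
raisedForm c b y₀ y₁ =
  (one ⊕ s ^ suc b ⊗ s ^ c) ⊗ y₀ ⊕ s ^ suc (suc b) ⊗ s ^ c ⊗ (one ⊖ s ^ b) ⊗ y₁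

raisedForm-unfold : ∀ c b y₀ y₁ y₂ y₃ →
  y₀ ≈ (one ⊕ s ^ suc b) ⊗ y₁ ⊕ s ^ suc b ⊗ s ^ suc (suc c) ⊗ y₂ →
  y₁ ≈ (one ⊕ s ^ suc (suc b)) ⊗ y₂ ⊕ s ^ suc (suc b) ⊗ s ^ suc (suc c) ⊗ y₃ →
  raisedForm c b y₀ y₁ ≈ (one ⊕ s ^ suc b) ⊗ raisedForm c (suc b) y₁ y₂
                         ⊕ s ^ suc b ⊗ s ^ c ⊗ raisedForm c (suc (suc b)) y₂ y₃
raisedForm-unfold c b y₀ y₁ y₂ y₃ y₀-rec y₁-rec = begin
  raisedForm c b y₀ y₁
    ≈⟨ raisedForm-cong b (≈-trans y₀-rec (+-congʳ (⊗-cong (≈-refl {one ⊕ s ^ suc b}) y₁-rec))) y₁-rec ⟩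
  raisedForm c b Y₀ Y₁
    ≈⟨ solve 5 (λ s t v y₂ y₃ →
         let Y₁ = (con (+ 1) :+ s :* (s :* t)) :* y₂ :+ s :* (s :* t) :* (s :* (s :* v)) :* y₃
             Y₀ = (con (+ 1) :+ s :* t) :* Y₁ :+ s :* t :* (s :* (s :* v)) :* y₂
             L : _ → _ → _ → _
             L t y₀ y₁ = (con (+ 1) :+ s :* t :* v) :* y₀ :+ s :* (s :* t) :* v :* (con (+ 1) :- t) :* y₁
         in L t Y₀ Y₁ := (con (+ 1) :+ s :* t) :* L (s :* t) Y₁ y₂ :+ s :* t :* v :* L (s :* (s :* t)) y₂ y₃)
         ≈-refl s (s ^ b) (s ^ c) y₂ y₃ ⟩
  (one ⊕ s ^ suc b) ⊗ raisedForm c (suc b) Y₁ y₂ ⊕ s ^ suc b ⊗ s ^ c ⊗ raisedForm c (suc (suc b)) y₂ y₃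
    ≈⟨ +-congʳ (⊗-cong (≈-refl {one ⊕ s ^ suc b}) (raisedForm-cong (suc b) (≈-sym y₁-rec) (≈-refl {y₂}))) ⟩
  (one ⊕ s ^ suc b) ⊗ raisedForm c (suc b) y₁ y₂ ⊕ s ^ suc b ⊗ s ^ c ⊗ raisedForm c (suc (suc b)) y₂ y₃ ∎
  where
  open ≈-Reasoning
  Y₁ = (one ⊕ s ^ suc (suc b)) ⊗ y₂ ⊕ s ^ suc (suc b) ⊗ s ^ suc (suc c) ⊗ y₃
  Y₀ = (one ⊕ s ^ suc b) ⊗ Y₁ ⊕ s ^ suc b ⊗ s ^ suc (suc c) ⊗ y₂
  raisedForm-cong : ∀ b {y₀ y₀′ y₁ y₁′} → y₀ ≈ y₀′ → y₁ ≈ y₁′ →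
                      raisedForm c b y₀ y₁ ≈ raisedForm c b y₀′ y₁′
  raisedForm-cong b y₀≈ y₁≈ =
    +-cong (⊗-cong (≈-refl {one ⊕ s ^ suc b ⊗ s ^ c}) y₀≈)
           (⊗-cong (≈-refl {s ^ suc (suc b) ⊗ s ^ c ⊗ (one ⊖ s ^ b)}) y₁≈)

-- Both sides satisfy the recurrence of tilings∞-unfold in b and are 1 modulo s^(b+1).
tilings∞≈raisedForm : ∀ c b →
  tilings∞ c (suc b) ≈ raisedForm c b (tilings∞ (suc (suc c)) (suc b)) (tilings∞ (suc (suc c)) (suc (suc b)))
tilings∞≈raisedForm c = recurrence-unique α β X Y (λ b → tilings∞-unfold c (suc b)) Y-rec boundary
  where
  α β X Y : ℕ → Series
  α b = one ⊕ s ^ suc b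
  β b = s ^ suc b ⊗ s ^ c
  X b = tilings∞ c (suc b)
  T : ℕ → Series
  T = tilings∞ (suc (suc c))
  Y b = raisedForm c b (T (suc b)) (T (suc (suc b)))
  Y-rec : ∀ b → Y b ≈ α b ⊗ Y (suc b) ⊕ β b ⊗ Y (suc (suc b))
  Y-rec b = raisedForm-unfold c b (T (suc b)) (T (2 + b)) (T (3 + b)) (T (4 + b))
                                            (tilings∞-unfold (suc (suc c)) (suc b))
                                            (tilings∞-unfold (suc (suc c)) (suc (suc b)))
  Y-≈[]-one : ∀ b → Y b ≈[ suc b ] one
  Y-≈[]-one b =
    ≈[]-trans (≈[]-⊕ (≈[]-⊗ (≈[]-trans (≈[]-⊕ (≈[]-refl {one}) (s^-⊗-≈[]-0 (suc b) (s ^ c)))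
                                        (≈⇒≈[] (+-identityʳ one)))
                             (tilings∞-≈[]-one (suc (suc c)) (suc b)))
                     (⊗-≈[]-0ˡ (tilings∞ (suc (suc c)) (suc (suc b)))
                       (⊗-≈[]-0ˡ (one ⊖ s ^ b) (≈[]-weaken (ℕₚ.n≤1+n (suc b)) (s^-⊗-≈[]-0 (suc (suc b)) (s ^ c))))))
              (≈⇒≈[] (≈-trans (+-identityʳ (one ⊗ one)) (⊗-identityˡ one)))
  boundary : ∀ b → X b ≈[ b ] Y b
  boundary b = ≈[]-weaken (ℕₚ.n≤1+n b) (≈[]-trans (tilings∞-≈[]-one c (suc b)) (≈[]-sym (Y-≈[]-one b)))

tilings∞-raise : ∀ c → tilings∞ c 1 ≈ (one ⊕ s ^ suc c) ⊗ tilings∞ (suc (suc c)) 1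
tilings∞-raise c = ≈-trans (tilings∞≈raisedForm c 0)
  (solve 4 (λ s v y₀ y₁ → (con (+ 1) :+ s :* con (+ 1) :* v) :* y₀
                           :+ s :* (s :* con (+ 1)) :* v :* (con (+ 1) :- con (+ 1)) :* y₁
                         := (con (+ 1) :+ s :* v) :* y₀)
         ≈-refl s (s ^ c) (tilings∞ (suc (suc c)) 1) (tilings∞ (suc (suc c)) 2))

tilings∞-raise-iterate : ∀ M → tilings∞ 1 1 ≈ ∏ (λ i → one ⊕ s ^ (2 * suc i)) M ⊗ tilings∞ (suc (2 * M)) 1
tilings∞-raise-iterate zero    = ≈-sym (⊗-identityˡ (tilings∞ 1 1))
tilings∞-raise-iterate (suc M) = begin
  tilings∞ 1 1                                 ≈⟨ tilings∞-raise-iterate M ⟩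
  E ⊗ tilings∞ (suc (2 * M)) 1                 ≈⟨ ⊗-cong (≈-refl {E}) (tilings∞-raise (suc (2 * M))) ⟩
  E ⊗ ((one ⊕ s ^ (2 + 2 * M)) ⊗ T (2 + 2 * M)) ≈⟨ ⊗-assoc E _ (T (2 + 2 * M)) ⟨
  E ⊗ (one ⊕ s ^ (2 + 2 * M)) ⊗ T (2 + 2 * M)   ≈⟨ ⊗-cong (⊗-cong (≈-refl {E}) (one⊕s^-cong (2M+2≡)))
                                                          (≡⇒≈ (cong T 2M+2≡)) ⟩
  E ⊗ (one ⊕ s ^ (2 * suc M)) ⊗ T (2 * suc M)   ∎
  where
  open ≈-Reasoning
  E = ∏ (λ i → one ⊕ s ^ (2 * suc i)) M
  T : ℕ → Series
  T c = tilings∞ (suc c) 1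
  2M+2≡ : 2 + 2 * M ≡ 2 * suc M
  2M+2≡ = sym (ℕₚ.*-suc 2 M)

tilings∞≈[]distinct : ∀ c m a → c < m + suc a →
  tilings∞ c (suc a) ≈[ suc c ] ∏ (λ i → one ⊕ s ^ (suc a + i)) m
tilings∞≈[]distinct c zero    a c<1+a = ≈[]-weaken c<1+a (tilings∞-≈[]-one c (suc a))
tilings∞≈[]distinct c (suc m) a c<m+2+a =
  ≈[]-trans (≈⇒≈[] (tilings∞-unfold c (suc a)))
  (≈[]-trans (≈[]-⊕ (≈[]-⊗ (≈[]-refl {one ⊕ s ^ suc a}) (tilings∞≈[]distinct c m (suc a) c<m+2+a′))
                    (≈[]-weaken (s≤s (ℕₚ.m≤n+m c a)) (dimer-≈[]-0 (suc a) c (tilings∞ c (3 + a)))))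
  (≈⇒≈[] (begin
    (one ⊕ s ^ suc a) ⊗ D ⊕ 0ₛ
      ≈⟨ +-identityʳ _ ⟩
    (one ⊕ s ^ suc a) ⊗ D
      ≈⟨ ⊗-cong (one⊕s^-cong (sym (ℕₚ.+-identityʳ (suc a))))
                (∏-cong m λ i → one⊕s^-cong (sym (ℕₚ.+-suc (suc a) i))) ⟩
    (one ⊕ s ^ (suc a + 0)) ⊗ ∏ (λ i → one ⊕ s ^ (suc a + suc i)) m
      ≈⟨ ∏-cons (λ i → one ⊕ s ^ (suc a + i)) m ⟨
    ∏ (λ i → one ⊕ s ^ (suc a + i)) (suc m) ∎)))
  where
  open ≈-Reasoning
  D = ∏ (λ i → one ⊕ s ^ (suc (suc a) + i)) m
  c<m+2+a′ : c < m + suc (suc a)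
  c<m+2+a′ = ℕₚ.<-≤-trans c<m+2+a (ℕₚ.≤-reflexive (sym (ℕₚ.+-suc m (suc a))))

-- Euler's identity and the partial products

oddFactors : ℕ → Series
oddFactors = ∏ (λ i → one ⊖ s ^ suc (2 * i))

euler : ∀ N → ∏ (λ i → one ⊕ s ^ suc i) N ⊗ oddFactors N ≈ ∏ (λ i → one ⊖ s ^ (suc N + i)) N
euler zero    = ⊗-identityˡ one
euler (suc N) = begin
  F ⊗ (one ⊕ u) ⊗ (oddFactors N ⊗ (one ⊖ s ^ suc (2 * N)))
    ≈⟨ solve 4 (λ F O u w → F :* (con (+ 1) :+ u) :* (O :* (con (+ 1) :- w))
                          := F :* O :* (con (+ 1) :- w) :* (con (+ 1) :+ u))
             ≈-refl F (oddFactors N) u (s ^ suc (2 * N)) ⟩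
  F ⊗ oddFactors N ⊗ (one ⊖ s ^ suc (2 * N)) ⊗ (one ⊕ u)
    ≈⟨ ⊗-cong (⊗-cong (euler N) (one⊖s^-cong (cong (λ k → suc (N + k)) (ℕₚ.+-identityʳ N))))
              (≈-refl {one ⊕ u}) ⟩
  ∏ (λ i → one ⊖ s ^ (suc N + i)) (suc N) ⊗ (one ⊕ u)
    ≈⟨ ⊗-cong (∏-cons (λ i → one ⊖ s ^ (suc N + i)) N) (≈-refl {one ⊕ u}) ⟩
  (one ⊖ s ^ (suc N + 0)) ⊗ ∏ (λ i → one ⊖ s ^ (suc N + suc i)) N ⊗ (one ⊕ u)
    ≈⟨ ⊗-cong (⊗-cong (one⊖s^-cong ((ℕₚ.+-identityʳ (suc N))))
                      (∏-cong N λ i → one⊖s^-cong ((ℕₚ.+-suc (suc N) i))))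
              (≈-refl {one ⊕ u}) ⟩
  (one ⊖ u) ⊗ P ⊗ (one ⊕ u)
    ≈⟨ solve 2 (λ u P → (con (+ 1) :- u) :* P :* (con (+ 1) :+ u) := P :* (con (+ 1) :- u :* u)) ≈-refl u P ⟩
  P ⊗ (one ⊖ u ⊗ u)
    ≈⟨ ⊗-cong (≈-refl {P}) (+-congˡ {one} (-‿cong (≈-trans (≈-sym (^-homo-* s (suc N) (suc N)))
                                                        (≡⇒≈ (cong (s ^_) (ℕₚ.+-suc (suc N) N)))))) ⟩
  ∏ (λ i → one ⊖ s ^ (suc (suc N) + i)) (suc N) ∎
  where
  open ≈-Reasoning
  F = ∏ (λ i → one ⊕ s ^ suc i) N
  u = s ^ suc N
  P = ∏ (λ i → one ⊖ s ^ (suc (suc N) + i)) N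

oddFactors-stable : ∀ k M → oddFactors (k + M) ≈[ suc (2 * M) ] oddFactors M
oddFactors-stable zero    M = ≈[]-refl
oddFactors-stable (suc k) M =
  ≈[]-trans (≈[]-⊗ (oddFactors-stable k M)
                   (≈[]-weaken (s≤s (ℕₚ.*-monoʳ-≤ 2 (ℕₚ.m≤n+m M k))) (one⊖s^-≈[]-one (suc (2 * (k + M))))))
            (≈⇒≈[] (*-identityʳ (oddFactors M)))

tilings∞-oddFactors : ∀ M → tilings∞ (suc (2 * M)) 1 ⊗ oddFactors M ≈[ suc (2 * M) ] one
tilings∞-oddFactors M =
  ≈[]-trans (≈[]-⊗ (≈[]-weaken (ℕₚ.n≤1+n c) (tilings∞≈[]distinct c c 0 (ℕₚ.m<m+n c (s≤s z≤n))))
                   (≈[]-sym oddFactors-c≈M))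
  (≈[]-trans (≈⇒≈[] (euler c))
             (∏-≈[]-one c λ i → ≈[]-weaken (ℕₚ.m≤n⇒m≤n+o i (ℕₚ.n≤1+n c)) (one⊖s^-≈[]-one (suc c + i))))
  where
  c = suc (2 * M)
  oddFactors-c≈M : oddFactors c ≈[ c ] oddFactors M
  oddFactors-c≈M =
    ≈[]-trans (≈⇒≈[] (≡⇒≈ (cong (λ k → oddFactors (suc (M + k))) (ℕₚ.+-identityʳ M)))) (oddFactors-stable (suc M) M)

s^-coeff : ∀ e j → (s ^ e) j ≡ (if j ≡ᵇ e then + 1 else + 0)
s^-coeff zero    zero    = refl
s^-coeff zero    (suc j) = refl
s^-coeff (suc e) zero    = s-⊗ (s ^ e) 0
s^-coeff (suc e) (suc j) = trans (s-⊗ (s ^ e) (suc j)) (s^-coeff e j)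

onePlusPow≈ : ∀ e → onePlusPow e ≈ one ⊕ s ^ e
onePlusPow≈ e zero    = cong (+ 1 +ℤ_) (sym (s^-coeff e 0))
onePlusPow≈ e (suc j) = cong (+ 0 +ℤ_) (sym (s^-coeff e (suc j)))

geomInv-inverse : ∀ b → (one ⊖ s ^ suc b) ⊗ geomInv b ≈ one
geomInv-inverse b =
  ≈-trans (solve 2 (λ x g → (con (+ 1) :- x) :* g := g :- x :* g) ≈-refl (s ^ suc b) (geomInv b))
          (λ j → at j (below-or-shifted (suc b) j))
  where
  g = geomInv b
  at : ∀ j → j < suc b ⊎ ∃[ i ] j ≡ suc b + i → (g ⊖ s ^ suc b ⊗ g) j ≡ one j
  at j (inj₁ j<1+b) = trans (cong₂ (λ x y → x +ℤ -ℤ y) (g-below j j<1+b) (coeff (s^-⊗-≈[]-0 (suc b) g) j j<1+b))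
                            (ℤₚ.+-identityʳ (one j))
    where
    g-below : ∀ j → j < suc b → g j ≡ one j
    g-below j j<1+b rewrite ℕ.m<n⇒m%n≡m j<1+b with j
    ... | zero  = refl
    ... | suc _ = refl
  at _ (inj₂ (i , refl)) =
    trans (cong₂ (λ x y → x +ℤ -ℤ y) (cong (λ r → if r ≡ᵇ 0 then + 1 else + 0) period) (s^-⊗-shifted (suc b) g i))
          (ℤₚ.+-inverseʳ (g i))
    where
    period : (suc b + i) % suc b ≡ i % suc b
    period = trans (cong (_% suc b) (ℕₚ.+-comm (suc b) i)) (ℕ.[m+n]%n≡m%n i (suc b))

evenFactors : ℕ → Series
evenFactors = ∏ (λ i → one ⊕ s ^ (2 * suc i))

geomInvs : ℕ → Series
geomInvs = ∏ (λ i → geomInv (2 * i))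

partialProd≈ : ∀ M → partialProd M ≈ evenFactors M ⊗ geomInvs M
partialProd≈ zero    = ≈-sym (⊗-identityˡ one)
partialProd≈ (suc M) = begin
  partialProd M ⊗ onePlusPow (2 * suc M) ⊗ geomInv (2 * M)
    ≈⟨ ⊗-cong (⊗-cong (partialProd≈ M) (onePlusPow≈ (2 * suc M))) (≈-refl {geomInv (2 * M)}) ⟩
  evenFactors M ⊗ geomInvs M ⊗ (one ⊕ s ^ (2 * suc M)) ⊗ geomInv (2 * M)
    ≈⟨ solve 4 (λ E G x y → E :* G :* x :* y := E :* x :* (G :* y))
             ≈-refl (evenFactors M) (geomInvs M) (one ⊕ s ^ (2 * suc M)) (geomInv (2 * M)) ⟩
  evenFactors (suc M) ⊗ geomInvs (suc M) ∎
  where open ≈-Reasoning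

geomInvs-oddFactors : ∀ M → geomInvs M ⊗ oddFactors M ≈ one
geomInvs-oddFactors M = ≈-trans (∏-⊗ _ _ M) (≈[]⇒≈ λ n → ∏-≈[]-one M λ i →
  ≈⇒≈[] (≈-trans (⊗-comm (geomInv (2 * i)) (one ⊖ s ^ suc (2 * i))) (geomInv-inverse (2 * i))))

tilings∞≈[]partialProd : ∀ M → tilings∞ 1 1 ≈[ suc (2 * M) ] partialProd M
tilings∞≈[]partialProd M =
  ≈[]-trans (≈⇒≈[] (begin
    tilings∞ 1 1                  ≈⟨ tilings∞-raise-iterate M ⟩
    E ⊗ T                         ≈⟨ *-identityʳ (E ⊗ T) ⟨
    E ⊗ T ⊗ one                   ≈⟨ ⊗-cong (≈-refl {E ⊗ T}) (geomInvs-oddFactors M) ⟨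
    E ⊗ T ⊗ (G ⊗ O)               ≈⟨ solve 4 (λ E T G O → E :* T :* (G :* O) := E :* G :* (T :* O))
                                             ≈-refl E T G O ⟩
    E ⊗ G ⊗ (T ⊗ O)               ∎))
  (≈[]-trans (≈[]-⊗ (≈[]-refl {E ⊗ G}) (tilings∞-oddFactors M))
             (≈⇒≈[] (≈-trans (*-identityʳ (E ⊗ G)) (≈-sym (partialProd≈ M)))))
  where
  open ≈-Reasoning
  E = evenFactors M
  G = geomInvs M
  O = oddFactors M
  T = tilings∞ (suc (2 * M)) 1

-- Generating functions of subsets

∑ : List (List Bool) → (List Bool → ℤ) → ℤ
∑ L g = sumℤ (map g L)

∑-++ : ∀ L L′ g → ∑ (L ++ L′) g ≡ ∑ L g +ℤ ∑ L′ g
∑-++ []      L′ g = sym (ℤₚ.+-identityˡ (∑ L′ g))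
∑-++ (S ∷ L) L′ g = trans (cong (g S +ℤ_) (∑-++ L L′ g)) (sym (ℤₚ.+-assoc (g S) (∑ L g) (∑ L′ g)))

∑-map : ∀ h L g → ∑ (map h L) g ≡ ∑ L (λ S → g (h S))
∑-map h []      g = refl
∑-map h (S ∷ L) g = cong (g (h S) +ℤ_) (∑-map h L g)

∑-cong : ∀ L {g g′} → (∀ S → g S ≡ g′ S) → ∑ L g ≡ ∑ L g′
∑-cong []      g≡g′ = refl
∑-cong (S ∷ L) g≡g′ = cong₂ _+ℤ_ (g≡g′ S) (∑-cong L g≡g′)

∑-zero : ∀ L {g} → (∀ S → g S ≡ + 0) → ∑ L g ≡ + 0
∑-zero []      g≡0 = refl
∑-zero (S ∷ L) g≡0 = cong₂ _+ℤ_ (g≡0 S) (∑-zero L g≡0)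

∑-* : ∀ c L g → ∑ L (λ S → c *ℤ g S) ≡ c *ℤ ∑ L g
∑-* c []      g = sym (ℤₚ.*-zeroʳ c)
∑-* c (S ∷ L) g = trans (cong (c *ℤ g S +ℤ_) (∑-* c L g)) (sym (ℤₚ.*-distribˡ-+ c (g S) (∑ L g)))

∑-subsets-cons : ∀ m g →
  ∑ (subsets (suc m)) g ≡ ∑ (subsets m) (λ S → g (false ∷ S)) +ℤ ∑ (subsets m) (λ S → g (true ∷ S))
∑-subsets-cons m g = trans (∑-++ (map (false ∷_) (subsets m)) _ g)
                           (cong₂ _+ℤ_ (∑-map (false ∷_) (subsets m) g) (∑-map (true ∷_) (subsets m) g))

∑-subsets-snoc : ∀ m g →
  ∑ (subsets (suc m)) g ≡ ∑ (subsets m) (λ S → g (S ++ [ false ])) +ℤ ∑ (subsets m) (λ S → g (S ++ [ true ]))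
∑-subsets-snoc zero    g = cong (_+ℤ (g [ true ] +ℤ + 0)) (sym (ℤₚ.+-identityʳ (g [ false ])))
∑-subsets-snoc (suc m) g = begin
  ∑ (subsets (2 + m)) g
    ≡⟨ ∑-subsets-cons (suc m) g ⟩
  ∑ (subsets (suc m)) (λ S → g (false ∷ S)) +ℤ ∑ (subsets (suc m)) (λ S → g (true ∷ S))
    ≡⟨ cong₂ _+ℤ_ (∑-subsets-snoc m (λ S → g (false ∷ S))) (∑-subsets-snoc m (λ S → g (true ∷ S))) ⟩
  (part false false +ℤ part false true) +ℤ (part true false +ℤ part true true)
    ≡⟨ interchange (part false false) (part false true) (part true false) (part true true) ⟩
  (part false false +ℤ part true false) +ℤ (part false true +ℤ part true true)
    ≡⟨ cong₂ _+ℤ_ (∑-subsets-cons m (λ S → g (S ++ [ false ]))) (∑-subsets-cons m (λ S → g (S ++ [ true ]))) ⟨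
  ∑ (subsets (suc m)) (λ S → g (S ++ [ false ])) +ℤ ∑ (subsets (suc m)) (λ S → g (S ++ [ true ])) ∎
  where
  open ≡-Reasoning
  part : Bool → Bool → ℤ
  part b b′ = ∑ (subsets m) (λ S → g (b ∷ S ++ [ b′ ]))

∑-subsets-cong : ∀ m {g g′} → (∀ S → length S ≡ m → g S ≡ g′ S) → ∑ (subsets m) g ≡ ∑ (subsets m) g′
∑-subsets-cong zero    g≡g′ = cong (_+ℤ + 0) (g≡g′ [] refl)
∑-subsets-cong (suc m) {g} {g′} g≡g′ =
  trans (∑-subsets-cons m g)
        (trans (cong₂ _+ℤ_ (∑-subsets-cong m (λ S ∣S∣≡m → g≡g′ (false ∷ S) (cong suc ∣S∣≡m)))
                           (∑-subsets-cong m (λ S ∣S∣≡m → g≡g′ (true ∷ S) (cong suc ∣S∣≡m))))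
               (sym (∑-subsets-cons m g′)))

generating : (List Bool → ℕ) → (List Bool → ℤ) → List (List Bool) → Series
generating σ w L j = ∑ L (λ S → if σ S ≡ᵇ j then w S else + 0)

generating-++ : ∀ σ w L L′ → generating σ w (L ++ L′) ≈ generating σ w L ⊕ generating σ w L′
generating-++ σ w L L′ j = ∑-++ L L′ _

generating-map : ∀ σ w h L → generating σ w (map h L) ≈ generating (λ S → σ (h S)) (λ S → w (h S)) L
generating-map σ w h L j = ∑-map h L _

generating-shift : ∀ a σ w L → generating (λ S → a + σ S) w L ≈ s ^ a ⊗ generating σ w L
generating-shift a σ w L j with below-or-shifted a j
... | inj₁ j<a       = trans (∑-zero L λ S → cong (λ b → if b then w S else + 0) (miss (σ S) j<a))
                             (sym (coeff (s^-⊗-≈[]-0 a (generating σ w L)) j j<a))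
  where
  miss : ∀ {e k} x → k < e → (e + x ≡ᵇ k) ≡ false
  miss {suc e} {zero}  x _         = refl
  miss {suc e} {suc k} x (s≤s k<e) = miss {e} {k} x k<e
... | inj₂ (i , refl) = trans (∑-cong L λ S → cong (λ b → if b then w S else + 0) (cancel a (σ S)))
                              (sym (s^-⊗-shifted a (generating σ w L) i))
  where
  cancel : ∀ e x → (e + x ≡ᵇ e + i) ≡ (x ≡ᵇ i)
  cancel zero    x = refl
  cancel (suc e) x = cancel e x

generating-scale : ∀ c σ w L → generating σ (λ S → c *ℤ w S) L ≈ const c ⊗ generating σ w L
generating-scale c σ w L j =
  trans (∑-cong L λ S → pull (σ S ≡ᵇ j)) (trans (∑-* c L _) (sym (const-⊗ c (generating σ w L) j)))
  where
  pull : ∀ {x} b → (if b then c *ℤ x else + 0) ≡ c *ℤ (if b then x else + 0)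
  pull true  = refl
  pull false = sym (ℤₚ.*-zeroʳ c)

generating-subsets-snoc : ∀ σ w m →
  generating σ w (subsets (suc m))
    ≈ generating (λ S → σ (S ++ [ false ])) (λ S → w (S ++ [ false ])) (subsets m)
    ⊕ generating (λ S → σ (S ++ [ true ])) (λ S → w (S ++ [ true ])) (subsets m)
generating-subsets-snoc σ w m j = ∑-subsets-snoc m _

generating-cong : ∀ {σ σ′ w w′} m j → (∀ S → length S ≡ m → σ S ≡ σ′ S) →
  (∀ S → length S ≡ m → σ S ≡ j → w S ≡ w′ S) →
  generating σ w (subsets m) j ≡ generating σ′ w′ (subsets m) j
generating-cong {σ} {σ′} {w} {w′} m j σ≡σ′ w≡w′ = ∑-subsets-cong m term
  where
  term : ∀ S → length S ≡ m → (if σ S ≡ᵇ j then w S else + 0) ≡ (if σ′ S ≡ᵇ j then w′ S else + 0)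
  term S ∣S∣≡m rewrite sym (σ≡σ′ S ∣S∣≡m) with σ S ≡ᵇ j in hit
  ... | true  = w≡w′ S ∣S∣≡m (ℕₚ.≡ᵇ⇒≡ (σ S) j (subst Data.Bool.T (sym hit) _))
  ... | false = refl

runsWeight : Bool → List Bool → ℤ
runsWeight p S = (+ 2) ^ℤ runStarts p S

-- Subsets of {a, …, a+m−1} weighted by 2^(number of runs); a − 1 counts as a member iff p.
runsGF : ℕ → ℕ → Bool → Series
runsGF m a p = generating (sigmaFrom a) (runsWeight p) (subsets m)

runsGF-cons : ∀ m a p → runsGF (suc m) a p ≈
  runsGF m (suc a) false ⊕ s ^ a ⊗ generating (sigmaFrom (suc a)) (λ S → runsWeight p (true ∷ S)) (subsets m)
runsGF-cons m a p =
  ≈-trans (generating-++ (sigmaFrom a) (runsWeight p) (map (false ∷_) (subsets m)) (map (true ∷_) (subsets m)))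
          (+-cong (generating-map (sigmaFrom a) (runsWeight p) (false ∷_) (subsets m))
                  (≈-trans (generating-map (sigmaFrom a) (runsWeight p) (true ∷_) (subsets m))
                           (generating-shift a (sigmaFrom (suc a)) (λ S → runsWeight p (true ∷ S)) (subsets m))))

runsGF-false : ∀ m a →
  runsGF (suc m) a false ≈ runsGF m (suc a) false ⊕ s ^ a ⊗ (const (+ 2) ⊗ runsGF m (suc a) true)
runsGF-false m a =
  ≈-trans (runsGF-cons m a false)
          (+-congˡ {runsGF m (suc a) false}
            (⊗-cong (≈-refl {s ^ a}) (generating-scale (+ 2) (sigmaFrom (suc a)) (runsWeight true) (subsets m))))

tilings∞-1-true : ∀ a →
  tilings∞ 1 a ≈ tilings∞ 1 (suc a) ⊕ s ^ suc a ⊗ tilings∞ 1 (2 + a) ⊕ s ^ a ⊗ tilings∞ 1 (suc a)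
tilings∞-1-true a = ≈-trans (tilings∞-unfold 1 a)
  (solve 4 (λ s t y₁ y₂ → (con (+ 1) :+ t) :* y₁ :+ t :* (s :* con (+ 1)) :* y₂
                         := y₁ :+ s :* t :* y₂ :+ t :* y₁)
         ≈-refl s (s ^ a) (tilings∞ 1 (suc a)) (tilings∞ 1 (2 + a)))

tilings∞-1-false : ∀ a →
  tilings∞ 1 a ⊕ s ^ a ⊗ tilings∞ 1 (suc a)
    ≈ tilings∞ 1 (suc a) ⊕ s ^ suc a ⊗ tilings∞ 1 (2 + a) ⊕ s ^ a ⊗ (const (+ 2) ⊗ tilings∞ 1 (suc a))
tilings∞-1-false a = ≈-trans (+-congʳ (tilings∞-1-true a))
  (solve 4 (λ s t y₁ y₂ → y₁ :+ s :* t :* y₂ :+ t :* y₁ :+ t :* y₁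
                         := y₁ :+ s :* t :* y₂ :+ t :* (con (+ 2) :* y₁))
         ≈-refl s (s ^ a) (tilings∞ 1 (suc a)) (tilings∞ 1 (2 + a)))

runsGF≈[]tilings∞ : ∀ m a →
  runsGF m a true  ≈[ a + m ] tilings∞ 1 a ×
  runsGF m a false ≈[ a + m ] tilings∞ 1 a ⊕ s ^ a ⊗ tilings∞ 1 (suc a)
runsGF≈[]tilings∞ zero a =
  ≈[]-weaken a+0≤a (≈[]-trans (≈⇒≈[] (runsGF-0 {true})) (≈[]-sym (tilings∞-≈[]-one 1 a))) ,
  ≈[]-weaken a+0≤a (≈[]-trans (≈⇒≈[] (runsGF-0 {false}))
                              (≈[]-sym (≈[]-trans (≈[]-⊕ (tilings∞-≈[]-one 1 a) (s^-⊗-≈[]-0 a (tilings∞ 1 (suc a))))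
                                                  (≈⇒≈[] (+-identityʳ one)))))
  where
  a+0≤a : a + 0 ≤ a
  a+0≤a = ℕₚ.≤-reflexive (ℕₚ.+-identityʳ a)
  runsGF-0 : ∀ {p} → runsGF 0 a p ≈ one
  runsGF-0 zero    = refl
  runsGF-0 (suc j) = refl
runsGF≈[]tilings∞ (suc m) a with runsGF≈[]tilings∞ m (suc a)
... | true≈ , false≈ =
  ≈[]-trans (≈⇒≈[] (runsGF-cons m a true))
            (≈[]-trans (≈[]-⊕ (≈[]-weaken a+1+m≤ false≈) (shifted true≈))
                       (≈⇒≈[] (≈-sym (tilings∞-1-true a)))) ,
  ≈[]-trans (≈⇒≈[] (runsGF-false m a))
            (≈[]-trans (≈[]-⊕ (≈[]-weaken a+1+m≤ false≈) (shifted (≈[]-⊗ (≈[]-refl {const (+ 2)}) true≈)))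
                       (≈⇒≈[] (≈-sym (tilings∞-1-false a))))
  where
  a+1+m≤ : a + suc m ≤ suc a + m
  a+1+m≤ = ℕₚ.≤-reflexive (ℕₚ.+-suc a m)
  shifted : ∀ {f g} → f ≈[ suc a + m ] g → s ^ a ⊗ f ≈[ a + suc m ] s ^ a ⊗ g
  shifted f≈g = ≈[]-weaken (ℕₚ.m≤n⇒m≤o+n a a+1+m≤) (≈[]-s^ a f≈g)

lastOr : Bool → List Bool → Bool
lastOr p []      = p
lastOr p (b ∷ S) = lastOr b S

lastOr-snoc : ∀ p S b → lastOr p (S ++ [ b ]) ≡ b
lastOr-snoc p []      b = refl
lastOr-snoc p (x ∷ S) b = lastOr-snoc x S b

lastB-snoc : ∀ S b → lastB (S ++ [ b ]) ≡ b
lastB-snoc []          b = refl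
lastB-snoc (x ∷ [])    b = refl
lastB-snoc (x ∷ y ∷ S) b = lastB-snoc (y ∷ S) b

runStarts-++ : ∀ p S S′ → runStarts p (S ++ S′) ≡ runStarts p S + runStarts (lastOr p S) S′
runStarts-++ p []      S′ = refl
runStarts-++ p (b ∷ S) S′ =
  trans (cong (_+_ starts) (runStarts-++ b S S′)) (sym (ℕₚ.+-assoc starts (runStarts b S) (runStarts (lastOr b S) S′)))
  where starts = if b ∧ not p then 1 else 0

sigmaFrom-snoc : ∀ a S b → sigmaFrom a (S ++ [ b ]) ≡ sigmaFrom a S + (if b then a + length S else 0)
sigmaFrom-snoc a []      true  = trans (ℕₚ.+-identityʳ a) (sym (ℕₚ.+-identityʳ a))
sigmaFrom-snoc a []      false = refl
sigmaFrom-snoc a (x ∷ S) b     = begin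
  (if x then a else 0) + sigmaFrom (suc a) (S ++ [ b ])
    ≡⟨ cong (_+_ (if x then a else 0)) (sigmaFrom-snoc (suc a) S b) ⟩
  (if x then a else 0) + (sigmaFrom (suc a) S + (if b then suc a + length S else 0))
    ≡⟨ ℕₚ.+-assoc (if x then a else 0) _ _ ⟨
  (if x then a else 0) + sigmaFrom (suc a) S + (if b then suc a + length S else 0)
    ≡⟨ cong (λ e → (if x then a else 0) + sigmaFrom (suc a) S + (if b then e else 0)) (sym (ℕₚ.+-suc a (length S))) ⟩
  (if x then a else 0) + sigmaFrom (suc a) S + (if b then a + suc (length S) else 0) ∎
  where open ≡-Reasoning

allTrue-++ : ∀ S S′ → allTrue (S ++ S′) ≡ allTrue S ∧ allTrue S′
allTrue-++ []      S′ = refl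
allTrue-++ (b ∷ S) S′ = trans (cong (b ∧_) (allTrue-++ S S′)) (sym (Boolₚ.∧-assoc b (allTrue S) (allTrue S′)))

runWeight-2-1 : ∀ k c → runWeight (+ 2) (+ 1) k c ≡ (+ 2) ^ℤ c
runWeight-2-1 k c = trans (cong₂ (λ x y → x *ℤ (+ 2) ^ℤ c *ℤ y) (ℤₚ.^-zeroˡ k) (ℤₚ.^-zeroˡ (k ∸ c)))
                          (trans (ℤₚ.*-identityʳ _) (ℤₚ.*-identityˡ _))

circWeight-non-full : ∀ n S → allTrue S ≡ false → circWeight n (+ 2) (+ 1) S ≡ (+ 2) ^ℤ runsCyc S
circWeight-non-full n S not-full rewrite not-full = runWeight-2-1 (size S) (runsCyc S)

circWeight-snoc-false : ∀ n S → circWeight n (+ 2) (+ 1) (S ++ [ false ]) ≡ runsWeight false S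
circWeight-snoc-false n S = begin
  circWeight n (+ 2) (+ 1) (S ++ [ false ])
    ≡⟨ circWeight-non-full n (S ++ [ false ]) (trans (allTrue-++ S [ false ]) (Boolₚ.∧-zeroʳ (allTrue S))) ⟩
  (+ 2) ^ℤ runStarts (lastB (S ++ [ false ])) (S ++ [ false ])
    ≡⟨ cong (λ p → (+ 2) ^ℤ runStarts p (S ++ [ false ])) (lastB-snoc S false) ⟩
  (+ 2) ^ℤ runStarts false (S ++ [ false ])
    ≡⟨ cong ((+ 2) ^ℤ_) (trans (runStarts-++ false S [ false ]) (ℕₚ.+-identityʳ (runStarts false S))) ⟩
  runsWeight false S ∎
  where open ≡-Reasoning

-- If σ(S) < |S| then the last element of S is absent, so adding it back opens a new cyclic run.
circWeight-snoc-true : ∀ n S → sigma S < length S →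
  circWeight n (+ 2) (+ 1) (S ++ [ true ]) ≡ + 2 *ℤ runsWeight true S
circWeight-snoc-true n S σ<∣S∣ with reverseView S
... | S′ ∶ _ ∶ʳ true = ⊥-elim (ℕₚ.<⇒≱ σ<∣S∣ ∣S∣≤σ)
  where
  ∣S∣≤σ : length (S′ ++ [ true ]) ≤ sigma (S′ ++ [ true ])
  ∣S∣≤σ = begin
    length (S′ ++ [ true ])                ≡⟨ Listₚ.length-++ S′ ⟩
    length S′ + 1                          ≡⟨ ℕₚ.+-comm (length S′) 1 ⟩
    1 + length S′                          ≤⟨ ℕₚ.m≤n+m _ (sigma S′) ⟩
    sigma S′ + (1 + length S′)             ≡⟨ sigmaFrom-snoc 1 S′ true ⟨
    sigma (S′ ++ [ true ])                 ∎
    where open ℕₚ.≤-Reasoning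
... | S′ ∶ _ ∶ʳ false = begin
  circWeight n (+ 2) (+ 1) (T ++ [ true ])
    ≡⟨ circWeight-non-full n (T ++ [ true ]) not-full ⟩
  (+ 2) ^ℤ runStarts (lastB (T ++ [ true ])) (T ++ [ true ])
    ≡⟨ cong (λ p → (+ 2) ^ℤ runStarts p (T ++ [ true ])) (lastB-snoc T true) ⟩
  (+ 2) ^ℤ runStarts true (T ++ [ true ])
    ≡⟨ cong ((+ 2) ^ℤ_) new-run ⟩
  (+ 2) ^ℤ (1 + runStarts true T) ∎
  where
  open ≡-Reasoning
  T = S′ ++ [ false ]
  not-full : allTrue (T ++ [ true ]) ≡ false
  not-full = trans (allTrue-++ T [ true ])
                   (cong (_∧ true) (trans (allTrue-++ S′ [ false ]) (Boolₚ.∧-zeroʳ (allTrue S′))))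
  new-run : runStarts true (T ++ [ true ]) ≡ 1 + runStarts true T
  new-run = trans (runStarts-++ true T [ true ])
                  (trans (cong (λ p → runStarts true T + runStarts p [ true ]) (lastOr-snoc true S′ false))
                         (ℕₚ.+-comm (runStarts true T) 1))

withSigma-generating : ∀ j w L → sumℤ (map w (withSigma j L)) ≡ generating sigma w L j
withSigma-generating j w []      = refl
withSigma-generating j w (S ∷ L) with sigma S ≡ᵇ j
... | true  = cong (w S +ℤ_) (withSigma-generating j w L)
... | false = trans (withSigma-generating j w L) (sym (ℤₚ.+-identityˡ _))

Gseg≡runsGF : ∀ n j → Gseg n (+ 2) (+ 1) j ≡ runsGF n 1 false j
Gseg≡runsGF n j = trans (withSigma-generating j _ (subsets n))
                        (generating-cong {σ = sigma} n j (λ _ _ → refl) (λ S _ _ → runWeight-2-1 (size S) (runsSeg S)))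

-- The subsets S of {1, …, m} with m + 1 adjoined, weighted cyclically and indexed by σ(S).
lastAdjoined : ℕ → Series
lastAdjoined m = generating sigma (λ S → circWeight (suc m) (+ 2) (+ 1) (S ++ [ true ])) (subsets m)

Gcirc-Gseg : ∀ m j →
  Gcirc (3 + m) (+ 2) (+ 1) j - Gseg (2 + m) (+ 2) (+ 1) j ≡ (s ^ (3 + m) ⊗ lastAdjoined (2 + m)) j
Gcirc-Gseg m j = begin
  Gcirc (3 + m) (+ 2) (+ 1) j - Gseg (2 + m) (+ 2) (+ 1) j
    ≡⟨ cong₂ _-_ (trans (withSigma-generating j _ (subsets (3 + m))) (generating-subsets-snoc sigma _ (2 + m) j))
                 (Gseg≡runsGF (2 + m) j) ⟩
  (old j +ℤ new j) - runsGF (2 + m) 1 false j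
    ≡⟨ cong (λ x → (x +ℤ new j) - runsGF (2 + m) 1 false j) old≡ ⟩
  (runsGF (2 + m) 1 false j +ℤ new j) - runsGF (2 + m) 1 false j
    ≡⟨ xyx⁻¹≈y (runsGF (2 + m) 1 false j) (new j) ⟩
  new j
    ≡⟨ generating-cong (2 + m) j (λ S ∣S∣≡ → trans (sigmaFrom-snoc 1 S true)
                                               (trans (cong (λ l → sigma S + suc l) ∣S∣≡) (ℕₚ.+-comm (sigma S) (3 + m))))
                                 (λ _ _ _ → refl) ⟩
  generating (λ S → 3 + m + sigma S) (λ S → circWeight (3 + m) (+ 2) (+ 1) (S ++ [ true ])) (subsets (2 + m)) j
    ≡⟨ generating-shift (3 + m) sigma _ (subsets (2 + m)) j ⟩
  (s ^ (3 + m) ⊗ lastAdjoined (2 + m)) j ∎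
  where
  open ≡-Reasoning
  open Algebra.Properties.AbelianGroup ℤₚ.+-0-abelianGroup using (xyx⁻¹≈y)
  cw = circWeight (3 + m) (+ 2) (+ 1)
  old new : Series
  old = generating (λ S → sigma (S ++ [ false ])) (λ S → cw (S ++ [ false ])) (subsets (2 + m))
  new = generating (λ S → sigma (S ++ [ true ])) (λ S → cw (S ++ [ true ])) (subsets (2 + m))
  old≡ : old j ≡ runsGF (2 + m) 1 false j
  old≡ = generating-cong (2 + m) j (λ S _ → trans (sigmaFrom-snoc 1 S false) (ℕₚ.+-identityʳ (sigma S)))
                                   (λ S _ _ → circWeight-snoc-false (3 + m) S)

lastAdjoined-coeff : ∀ m k → k < m → lastAdjoined m k ≡ + 2 *ℤ runsGF m 1 true k
lastAdjoined-coeff m k k<m =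
  trans (generating-cong {σ = sigma} m k (λ _ _ → refl) new-run)
        (trans (generating-scale (+ 2) sigma (runsWeight true) (subsets m) k) (const-⊗ (+ 2) (runsGF m 1 true) k))
  where
  new-run : ∀ S → length S ≡ m → sigma S ≡ k →
            circWeight (suc m) (+ 2) (+ 1) (S ++ [ true ]) ≡ + 2 *ℤ runsWeight true S
  new-run S ∣S∣≡m σ≡k = circWeight-snoc-true (suc m) S (subst₂ _<_ (sym σ≡k) (sym ∣S∣≡m) k<m)

2*x/2≡x : ∀ x → (+ 2 *ℤ x) / + 2 ≡ x
2*x/2≡x (+ n) = trans (div-pos-is-/ℕ (+ 2 *ℤ + n) 2)
                      (trans (cong (_/ℕ 2) (sym (ℤₚ.pos-* 2 n)))
                             (cong +_ (trans (cong (ℕ._/ 2) (ℕₚ.*-comm 2 n)) (ℕ.m*n/n≡m n 2))))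
2*x/2≡x -[1+ n ] = trans (div-pos-is-/ℕ (+ 2 *ℤ -[1+ n ]) 2) (trans (even-/ℕ q even) (cong (λ x → -ℤ (+ x)) half))
  where
  q = n + suc (n + 0)
  2+2n≡ : suc q ≡ suc n * 2
  2+2n≡ = ℕₚ.*-comm 2 (suc n)
  even : suc q % 2 ≡ 0
  even = trans (cong (_% 2) 2+2n≡) (ℕ.m*n%n≡0 (suc n) 2)
  half : suc q ℕ./ 2 ≡ suc n
  half = trans (cong (ℕ._/ 2) 2+2n≡) (ℕ.m*n/n≡m (suc n) 2)
  even-/ℕ : ∀ q → suc q % 2 ≡ 0 → -[1+ q ] /ℕ 2 ≡ -ℤ (+ (suc q ℕ./ 2))
  even-/ℕ q even with suc q % 2 | even
  ... | .0 | refl = refl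

G2-below : ∀ m j → j < 3 + m → G2 (3 + m) (+ 2) (+ 1) j ≡ + 0
G2-below m j j<3+m = cong (_/ + 2) (trans (Gcirc-Gseg m j) (coeff (s^-⊗-≈[]-0 (3 + m) (lastAdjoined (2 + m))) j j<3+m))

G2-shifted : ∀ m k → k < 2 + m → G2 (3 + m) (+ 2) (+ 1) (3 + m + k) ≡ runsGF (2 + m) 1 true k
G2-shifted m k k<2+m =
  trans (cong (_/ + 2) (trans (Gcirc-Gseg m (3 + m + k))
                              (trans (s^-⊗-shifted (3 + m) (lastAdjoined (2 + m)) k) (lastAdjoined-coeff (2 + m) k k<2+m))))
        (2*x/2≡x (runsGF (2 + m) 1 true k))

mainTheorem10 : (∀ (n j : ℕ) → 2 ≤ n → j < n → G2 n (+ 2) (+ 1) j ≡ + 0)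
    × (∀ (k : ℕ) → ∃[ N ] (∀ (n M : ℕ) → N ≤ n → N ≤ M →
    G2 n (+ 2) (+ 1) (n + k) ≡ partialProd M k))
mainTheorem10 = vanishing , convergence
  where
  vanishing : ∀ n j → 2 ≤ n → j < n → G2 n (+ 2) (+ 1) j ≡ + 0
  vanishing 2                   0 _ _   = refl
  vanishing 2                   1 _ _   = refl
  vanishing 2                   (suc (suc _)) _ (s≤s (s≤s ()))
  vanishing 1                   _ (s≤s ()) _
  vanishing (suc (suc (suc m))) j _ j<n = G2-below m j j<n
  convergence : ∀ k → ∃[ N ] (∀ n M → N ≤ n → N ≤ M → G2 n (+ 2) (+ 1) (n + k) ≡ partialProd M k)
  convergence k = 3 + k , limit
    where
    limit : ∀ n M → 3 + k ≤ n → 3 + k ≤ M → G2 n (+ 2) (+ 1) (n + k) ≡ partialProd M k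
    limit (suc (suc (suc m))) M (s≤s (s≤s (s≤s k≤m))) 3+k≤M = begin
      G2 (3 + m) (+ 2) (+ 1) (3 + m + k)  ≡⟨ G2-shifted m k (s≤s (ℕₚ.m≤n⇒m≤1+n k≤m)) ⟩
      runsGF (2 + m) 1 true k             ≡⟨ coeff (proj₁ (runsGF≈[]tilings∞ (2 + m) 1)) k k<3+m ⟩
      tilings∞ 1 1 k                      ≡⟨ coeff (tilings∞≈[]partialProd M) k k<1+2M ⟩
      partialProd M k                     ∎
      where
      open ≡-Reasoning
      k<3+m : k < 3 + m
      k<3+m = s≤s (ℕₚ.m≤n⇒m≤1+n (ℕₚ.m≤n⇒m≤1+n k≤m))
      k<1+2M : k < suc (2 * M)
      k<1+2M = s≤s (ℕₚ.≤-trans (ℕₚ.≤-trans (ℕₚ.m≤n+m k 3) 3+k≤M) (ℕₚ.m≤n*m M 2))
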